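{- Let ${\bf\Gamma}$ be a class of sets (assigning to each topological space $Z$ a family ${\bf\Gamma}(Z)$ of subsets of $Z$) that is closed under continuous pre-images. Let $X,Y$ be topological spaces, $\kappa$ a finite natural number, and $A\in{\bf\Gamma}(X\times Y)$ be a union of $\kappa$ rectangles $A_n\times B_n$ with $A_n\subseteq X$ arbitrary and $B_n\subseteq Y$ open. Then $A$ is the union of at most $2^{2^\kappa}$ rectangles $C\times D$ with $C\in{\bf\Gamma}(X)$ and $D\subseteq Y$ open. -}

module Defs where

open import Level using (0ℓ)
open import Data.Product using (Σ; ∃; _×_; _,_; proj₁; proj₂)
open import Data.Sum using (_⊎_)
open import Relation.Nullary using (¬_)
open import Function.Bundles using (_⇔_; Equivalence)
open import Data.Unit using (⊤; tt)

Subset : Set → Set₁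
Subset X = X → Set

_≐_ : {X : Set} → Subset X → Subset X → Set
U ≐ V = ∀ x → U x ⇔ V x

-- A topological space: carrier + family of open sets (as in the paper's
-- ambient classical set theory, openness is invariant under extensional
-- equality of subsets).
record Space : Set₂ where
  field
    Carrier   : Set
    Open      : Subset Carrier → Set₁
    open-ext  : ∀ {U V} → U ≐ V → Open U → Open V
    open-univ : Open (λ _ → ⊤)
    open-∩    : ∀ {U V} → Open U → Open V → Open (λ x → U x × V x)
    open-⋃    : ∀ {I : Set} (U : I → Subset Carrier) →
                (∀ i → Open (U i)) → Open (λ x → Σ I (λ i → U i x))
open Space public

Continuous : (Z W : Space) → (Carrier Z → Carrier W) → Set₁
Continuous Z W f = ∀ (U : Subset (Carrier W)) → Open W U → Open Z (λ z → U (f z))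

ProdOpen : (X Y : Space) → Subset (Carrier X × Carrier Y) → Set₁
ProdOpen X Y W =
  ∀ x y → W (x , y) →
    Σ (Subset (Carrier X)) λ U → Σ (Subset (Carrier Y)) λ V →
      Open X U × Open Y V × U x × V y ×
      (∀ x' y' → U x' → V y' → W (x' , y'))

_⊗_ : Space → Space → Space
X ⊗ Y = record
  { Carrier   = Carrier X × Carrier Y
  ; Open      = ProdOpen X Y
  ; open-ext  = ext
  ; open-univ = λ x y _ → (λ _ → ⊤) , (λ _ → ⊤) , open-univ X , open-univ Y , tt , tt , λ _ _ _ _ → tt
  ; open-∩    = inter
  ; open-⋃    = union
  }
  where
  ext : ∀ {U V} → U ≐ V → ProdOpen X Y U → ProdOpen X Y V
  ext {U} {V} eq oU x y vxy with oU x y (Equivalence.from (eq (x , y)) vxy)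
  ... | R , S , oR , oS , rx , sy , sub =
    R , S , oR , oS , rx , sy , λ x' y' r s → Equivalence.to (eq (x' , y')) (sub x' y' r s)
  inter : ∀ {U V} → ProdOpen X Y U → ProdOpen X Y V → ProdOpen X Y (λ p → U p × V p)
  inter oU oV x y (u , v) with oU x y u | oV x y v
  ... | R , S , oR , oS , rx , sy , sub | R' , S' , oR' , oS' , rx' , sy' , sub' =
    (λ a → R a × R' a) , (λ b → S b × S' b) , open-∩ X oR oR' , open-∩ Y oS oS' ,
    (rx , rx') , (sy , sy') , λ x' y' r s → sub x' y' (proj₁ r) (proj₁ s) , sub' x' y' (proj₂ r) (proj₂ s)
  union : ∀ {I : Set} (U : I → Subset (Carrier X × Carrier Y)) →
          (∀ i → ProdOpen X Y (U i)) → ProdOpen X Y (λ p → Σ I (λ i → U i p))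
  union U oU x y (i , u) with oU i x y u
  ... | R , S , oR , oS , rx , sy , sub = R , S , oR , oS , rx , sy , λ x' y' r s → i , sub x' y' r s

-- Since subsets are predicates, we require (as is automatic for sets in the
-- paper's set theory) that membership in Γ Z is invariant under extensional
-- equality.
Class : Set₂
Class = (Z : Space) → Subset (Carrier Z) → Set

ClassExtensional : Class → Set₂
ClassExtensional Γ = ∀ (Z : Space) {U V : Subset (Carrier Z)} → U ≐ V → Γ Z U → Γ Z V

ClosedUnderContinuousPreimages : Class → Set₂
ClosedUnderContinuousPreimages Γ =
  ∀ (Z W : Space) (f : Carrier Z → Carrier W) → Continuous Z W f →
    ∀ (S : Subset (Carrier W)) → Γ W S → Γ Z (λ z → S (f z))

-- Excluded middle (the paper works in classical mathematics).
ExcludedMiddle : Set₁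
ExcludedMiddle = ∀ (P : Set) → P ⊎ ¬ P

-- A point y of Y has a smallest neighbourhood ⋂ {Bₙ ∣ y ∈ Bₙ} among the finite
-- intersections of the Bₙ, and A is upward closed along it: if every Bₙ
-- containing y contains y', then (x , y) ∈ A implies (x , y') ∈ A. Hence A is the
-- union of the rectangles A^y × ⋂ {Bₙ ∣ y ∈ Bₙ}, where the section A^y is in Γ(X)
-- as the preimage of A under x ↦ (x , y). Both factors depend only on the set
-- {n ∣ y ∈ Bₙ}, so one representative point per such set suffices, giving at most
-- 2^κ ≤ 2^(2^κ) rectangles.
module Submission where

open import Defs
open import Data.Nat using (ℕ; zero; suc; _≤_; _^_; z≤n)
open import Data.Nat.Properties using (≤-trans; +-mono-≤; m≤m+n; m^n>0)
open import Data.Fin using (Fin; zero; suc; funToFin; finToFun)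
open import Data.Fin.Patterns using (0F; 1F)
open import Data.Fin.Properties using (∀-cons-⇔; finToFun-funToFin)
open import Data.Product using (Σ; _×_; _,_; proj₁; proj₂)
open import Data.Sum using (_⊎_; inj₁; inj₂)
open import Data.Unit using (tt)
open import Data.Empty using (⊥-elim)
open import Relation.Nullary using (¬_; contradiction)
open import Relation.Binary.PropositionalEquality using (_≡_; refl; sym; cong; module ≡-Reasoning)
open import Function.Bundles using (_⇔_; mk⇔; Equivalence)

open Equivalence using (to; from)

n≤2^n : ∀ n → n ≤ 2 ^ n
n≤2^n zero    = z≤n
n≤2^n (suc n) = +-mono-≤ (m^n>0 2 n) (≤-trans (n≤2^n n) (m≤m+n (2 ^ n) 0))

funToFin-injective : ∀ {m n} {f g : Fin m → Fin n} → funToFin f ≡ funToFin g → ∀ i → f i ≡ g i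
funToFin-injective {f = f} {g} eq i = begin
  f i                       ≡⟨ finToFun-funToFin f i ⟨
  finToFun (funToFin f) i   ≡⟨ cong (λ t → finToFun t i) eq ⟩
  finToFun (funToFin g) i   ≡⟨ finToFun-funToFin g i ⟩
  g i                       ∎
  where open ≡-Reasoning

⌊_⌋ : {P : Set} → P ⊎ ¬ P → Fin 2
⌊ inj₁ _ ⌋ = 1F
⌊ inj₂ _ ⌋ = 0F

⌊⌋-transport : {P Q : Set} (p : P ⊎ ¬ P) (q : Q ⊎ ¬ Q) → ⌊ p ⌋ ≡ ⌊ q ⌋ → P → Q
⌊⌋-transport _         (inj₁ q)  _  _ = q
⌊⌋-transport (inj₂ ¬p) (inj₂ _)  _  p = contradiction p ¬p
⌊⌋-transport (inj₁ _)  (inj₂ _)  () _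

choice-on-image : ExcludedMiddle → {A B : Set} (f : A → B) → A →
                  Σ (B → A) λ r → ∀ a → f (r (f a)) ≡ f a
choice-on-image em {A} {B} f a₀ = r , r-section
  where
  r : B → A
  r b with em (Σ A λ a → f a ≡ b)
  ... | inj₁ (a , _) = a
  ... | inj₂ _       = a₀

  r-section : ∀ a → f (r (f a)) ≡ f a
  r-section a with em (Σ A λ a' → f a' ≡ f a)
  ... | inj₁ (_ , fa'≡fa) = fa'≡fa
  ... | inj₂ ¬fiber       = contradiction (a , refl) ¬fiber

module _ (Z : Space) where

  open-if-locally-open : (U : Subset (Carrier Z)) →
    (∀ z → U z → Σ (Subset (Carrier Z)) λ V → Open Z V × V z × (∀ z' → V z' → U z')) →
    Open Z U
  open-if-locally-open U nbhd = open-ext Z (λ z → mk⇔ inside around) (open-⋃ Z V V-open)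
    where
    V : Σ (Carrier Z) U → Subset (Carrier Z)
    V (z , u) = proj₁ (nbhd z u)

    V-open : ∀ i → Open Z (V i)
    V-open (z , u) = proj₁ (proj₂ (nbhd z u))

    inside : ∀ {z'} → Σ (Σ (Carrier Z) U) (λ i → V i z') → U z'
    inside {z'} ((z , u) , v) = proj₂ (proj₂ (proj₂ (nbhd z u))) z' v

    around : ∀ {z} → U z → Σ (Σ (Carrier Z) U) (λ i → V i z)
    around {z} u = (z , u) , proj₁ (proj₂ (proj₂ (nbhd z u)))

  open-⋂ : ∀ {κ} (U : Fin κ → Subset (Carrier Z)) → (∀ n → Open Z (U n)) →
           Open Z (λ z → ∀ n → U n z)
  open-⋂ {zero}  U _  = open-ext Z (λ _ → mk⇔ (λ _ ()) (λ _ → tt)) (open-univ Z)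
  open-⋂ {suc κ} U oU = open-ext Z (λ _ → ∀-cons-⇔)
    (open-∩ Z (oU zero) (open-⋂ (λ n → U (suc n)) (λ n → oU (suc n))))

  open-guarded : {P : Set} → P ⊎ ¬ P → {U : Subset (Carrier Z)} → Open Z U →
                 Open Z (λ z → P → U z)
  open-guarded (inj₁ p)  oU = open-ext Z (λ _ → mk⇔ (λ u _ → u) (λ f → f p)) oU
  open-guarded (inj₂ ¬p) _  =
    open-ext Z (λ _ → mk⇔ (λ _ p → contradiction p ¬p) (λ _ → tt)) (open-univ Z)

pair-continuousˡ : (X Y : Space) (y : Carrier Y) → Continuous X (X ⊗ Y) (λ x → x , y)
pair-continuousˡ X Y y W oW = open-if-locally-open X _ λ x w →
  let R , _ , oR , _ , x∈R , y∈S , R×S⊆W = oW x y w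
  in R , oR , x∈R , λ x' x'∈R → R×S⊆W x' y x'∈R y∈S

Γ-section : (Γ : Class) → ClosedUnderContinuousPreimages Γ → (X Y : Space)
            {A : Subset (Carrier X × Carrier Y)} → Γ (X ⊗ Y) A →
            ∀ y → Γ X (λ x → A (x , y))
Γ-section Γ cl X Y {A} A∈Γ y = cl X (X ⊗ Y) (λ x → x , y) (pair-continuousˡ X Y y) A A∈Γ

module RectangleUnion
  (em : ExcludedMiddle) (X Y : Space) {κ : ℕ}
  (A : Subset (Carrier X × Carrier Y))
  (An : Fin κ → Subset (Carrier X)) (Bn : Fin κ → Subset (Carrier Y))
  (A≐⋃An×Bn : ∀ x y → A (x , y) ⇔ Σ (Fin κ) (λ n → An n x × Bn n y))
  where

  smallestNbhd : Carrier Y → Subset (Carrier Y)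
  smallestNbhd y y' = ∀ n → Bn n y → Bn n y'

  smallestNbhd-open : (∀ n → Open Y (Bn n)) → ∀ y → Open Y (smallestNbhd y)
  smallestNbhd-open oB y = open-⋂ Y _ λ n → open-guarded Y (em (Bn n y)) (oB n)

  A-upward : ∀ {x y y'} → smallestNbhd y y' → A (x , y) → A (x , y')
  A-upward {x} {y} {y'} y'∈Ny a with to (A≐⋃An×Bn x y) a
  ... | n , x∈An , y∈Bn = from (A≐⋃An×Bn x y') (n , x∈An , y'∈Ny n y∈Bn)

  membership : Carrier Y → Fin (2 ^ κ)
  membership y = funToFin λ n → ⌊ em (Bn n y) ⌋

  same-membership : ∀ {y y'} → membership y ≡ membership y' → smallestNbhd y y'
  same-membership {y} {y'} eq n =
    ⌊⌋-transport (em (Bn n y)) (em (Bn n y')) (funToFin-injective eq n)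

  module _ (y₀ : Carrier Y) where

    representative : Fin (2 ^ κ) → Carrier Y
    representative = proj₁ (choice-on-image em membership y₀)

    representative-membership : ∀ y → membership (representative (membership y)) ≡ membership y
    representative-membership = proj₂ (choice-on-image em membership y₀)

    C : Fin (2 ^ κ) → Subset (Carrier X)
    C t x = A (x , representative t)

    D : Fin (2 ^ κ) → Subset (Carrier Y)
    D t = smallestNbhd (representative t)

    A≐⋃C×D : ∀ x y → A (x , y) ⇔ Σ (Fin (2 ^ κ)) (λ t → C t x × D t y)
    A≐⋃C×D x y = mk⇔
      (λ a → membership y ,
             A-upward (same-membership (sym (representative-membership y))) a ,
             same-membership (representative-membership y))
      (λ { (_ , a , y∈D) → A-upward y∈D a })

proposition4p14 : ExcludedMiddle →
    (Γ : Class) → ClassExtensional Γ → ClosedUnderContinuousPreimages Γ →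
    (X Y : Space) (κ : ℕ) (A : Subset (Carrier X × Carrier Y)) → Γ (X ⊗ Y) A →
    (An : Fin κ → Subset (Carrier X)) (Bn : Fin κ → Subset (Carrier Y)) →
    (∀ n → Open Y (Bn n)) →
    (∀ x y → A (x , y) ⇔ Σ (Fin κ) (λ n → An n x × Bn n y)) →
    Σ ℕ λ m → m ≤ 2 ^ (2 ^ κ) ×
    Σ (Fin m → Subset (Carrier X)) λ C → Σ (Fin m → Subset (Carrier Y)) λ D →
    (∀ i → Γ X (C i)) × (∀ i → Open Y (D i)) ×
    (∀ x y → A (x , y) ⇔ Σ (Fin m) (λ i → C i x × D i y))
proposition4p14 em Γ _ cl X Y κ A A∈Γ An Bn oB A≐⋃An×Bn with em (Carrier Y)
... | inj₂ Y-empty =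
  0 , z≤n , (λ ()) , (λ ()) , (λ ()) , (λ ()) , λ _ y → ⊥-elim (Y-empty y)
... | inj₁ y₀ =
  2 ^ κ , n≤2^n (2 ^ κ) , C y₀ , D y₀ ,
  (λ t → Γ-section Γ cl X Y A∈Γ (representative y₀ t)) ,
  (λ t → smallestNbhd-open oB (representative y₀ t)) ,
  A≐⋃C×D y₀
  where open RectangleUnion em X Y A An Bn A≐⋃An×Bn
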